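{- If $s\geq 2$ and $t\geq 2$ are integers, then $\mathrm{oh}(K_s\square K_t)\geq s+t-2$.
   Context: $\mathrm{oh}(G)$ (Odd Hadwiger number) of a finite simple graph $G$ is the largest integer $m$ for which there exist $m$ pairwise vertex-disjoint trees $Z_1,\dots,Z_m$ in $G$ and a 2-colouring $c$ of $V(Z_1)\cup\dots\cup V(Z_m)$ that is proper on each $Z_k$, such that for every $k\neq k'$ there is an edge $xy\in E(G)$ with $x\in V(Z_k)$, $y\in V(Z_{k'})$, $c(x)=c(y)$. The Cartesian product $G\square H$ has vertex set $V(G)\times V(H)$, with $(v_1,u_1)\sim(v_2,u_2)$ iff ($v_1=v_2$ and $u_1u_2\in E(H)$) or ($u_1=u_2$ and $v_1v_2\in E(G)$). -}

module Defs where

open import Data.Nat using (ℕ; suc; _≤_)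
open import Data.Fin using (Fin)
open import Data.Bool using (Bool)
open import Data.Product using (Σ; ∃; _×_; _,_)
open import Data.Sum using (_⊎_)
open import Data.List using (List; []; _∷_; length)
open import Data.List.Relation.Unary.Unique.Propositional using (Unique)
open import Relation.Nullary using (¬_)
import Data.Empty
import Data.List
import Data.Nat
open import Relation.Binary.PropositionalEquality using (_≡_; _≢_)

record Graph (V : Set) : Set₁ where
  field
    Adj    : V → V → Set
    sym    : ∀ {x y} → Adj x y → Adj y x
    irrefl : ∀ {x} → ¬ Adj x x
open Graph public

K : (s : ℕ) → Graph (Fin s)
K s = record { Adj = λ x y → x ≢ y ; sym = λ p q → p (Relation.Binary.PropositionalEquality.sym q) ; irrefl = λ p → p Relation.Binary.PropositionalEquality.refl }

_□_ : {V W : Set} → Graph V → Graph W → Graph (V × W)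
_□_ {V} {W} G H = record { Adj = A ; sym = s ; irrefl = i }
  where
  A : V × W → V × W → Set
  A (v₁ , u₁) (v₂ , u₂) = (v₁ ≡ v₂ × Adj H u₁ u₂) ⊎ (u₁ ≡ u₂ × Adj G v₁ v₂)
  s : ∀ {x y} → A x y → A y x
  s (_⊎_.inj₁ (e , a)) = _⊎_.inj₁ (Relation.Binary.PropositionalEquality.sym e , Graph.sym H a)
  s (_⊎_.inj₂ (e , a)) = _⊎_.inj₂ (Relation.Binary.PropositionalEquality.sym e , Graph.sym G a)
  i : ∀ {x} → ¬ A x x
  i (_⊎_.inj₁ (_ , a)) = Graph.irrefl H a
  i (_⊎_.inj₂ (_ , a)) = Graph.irrefl G a

data Walk {V : Set} (E : V → V → Set) : V → V → Set where
  here : ∀ {x} → Walk E x x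
  step : ∀ {x y z} → E x y → Walk E y z → Walk E x z

data Path {V : Set} (E : V → V → Set) : List V → Set where
  nil  : Path E []
  one  : ∀ {x} → Path E (x ∷ [])
  cons : ∀ {x y vs} → E x y → Path E (y ∷ vs) → Path E (x ∷ y ∷ vs)

Cycle : {V : Set} → (E : V → V → Set) → Set
Cycle {V} E = Σ V λ v₀ → Σ (List V) λ rest → Σ V λ vₖ →
  (1 ≤ length rest) × Unique (v₀ ∷ (rest Data.List.++ (vₖ ∷ []))) ×
  Path E (v₀ ∷ (rest Data.List.++ (vₖ ∷ []))) × E vₖ v₀

record Tree {V : Set} (G : Graph V) : Set₁ where
  field
    VZ       : V → Set
    EZ       : V → V → Set
    EZ⊆G     : ∀ {x y} → EZ x y → Adj G x y
    EZ-sym   : ∀ {x y} → EZ x y → EZ y x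
    EZ-left  : ∀ {x y} → EZ x y → VZ x
    nonempty : ∃ VZ
    connected : ∀ {x y} → VZ x → VZ y → Walk EZ x y
    acyclic  : ¬ Cycle EZ
open Tree public

record OddModel {V : Set} (G : Graph V) (m : ℕ) : Set₁ where
  field
    Z        : Fin m → Tree G
    disjoint : ∀ {k k'} → k ≢ k' → ∀ {x} → VZ (Z k) x → VZ (Z k') x → Data.Empty.⊥
    c        : V → Bool
    proper   : ∀ k {x y} → EZ (Z k) x y → c x ≢ c y
    touching : ∀ {k k'} → k ≢ k' →
               ∃ λ (xy : V × V) → let (x , y) = xy in
                 Adj G x y × VZ (Z k) x × VZ (Z k') y × c x ≡ c y

-- oh(G) ≥ m  (oh is the largest such m; the property is downward closed).
_≤oh_ : {V : Set} → ℕ → Graph V → Set₁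
m ≤oh G = OddModel G m

{-# OPTIONS --safe #-}
module Submission where

open import Defs renaming (sym to Adj-sym)
open import Data.Nat using (ℕ; _≤_; _+_; _∸_; suc)
open import Data.Nat.Properties using (+-suc)
open import Data.Fin using (Fin; zero; suc)
open import Data.Fin.Properties using (+↔⊎)
open import Data.Bool using (Bool; true; false)
open import Data.Product using (∃; _×_; _,_)
open import Data.Sum using (_⊎_; inj₁; inj₂)
open import Data.Empty using (⊥; ⊥-elim)
open import Data.List using ([]; _∷_; _++_)
import Data.List.Relation.Unary.All as All
open import Data.List.Relation.Unary.AllPairs using (_∷_)
open import Data.List.Relation.Unary.Any using (here)
open import Data.List.Membership.Propositional using (_∈_)
open import Data.List.Membership.Propositional.Properties using (∈-++⁺ʳ)
open import Function.Bundles using (_↣_; Injection)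
open import Function.Properties.Inverse using (↔⇒↣)
open import Relation.Nullary using (¬_)
open import Relation.Binary.PropositionalEquality using (_≡_; _≢_; refl; sym; cong; subst)

-- The model uses s + t − 2 trees in K_s □ K_t, with the first row and column
-- of the grid as the spare ones: the singletons (i, 0) for i ≠ 0, and for
-- every j ≠ 0 the star spanning column j with centre (0, j).  Colour a vertex
-- true exactly when it lies outside row 0.  Then the stars are properly
-- coloured, two singletons touch along row 0 in colour true, a singleton (i, 0)
-- touches column j at (i, j) in colour true, and two columns touch along
-- row 0 in colour false.

module _ {V : Set} {E : V → V → Set} where

  private
    successor : ∀ {x vₖ} rest → Path E (x ∷ rest ++ vₖ ∷ []) →
                ∃ λ y → E x y × y ∈ rest ++ vₖ ∷ []
    successor []      (cons e one) = _ , e , here refl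
    successor (_ ∷ _) (cons e _)   = _ , e , here refl

    ≡-both : ∀ {x y c : V} → x ≢ y → x ≡ c → y ≡ c → ⊥
    ≡-both x≢y refl refl = x≢y refl

  -- c lies on the edge v₀ r and on both cycle edges next to it, which meet
  -- v₀ r in different vertices.
  star-acyclic : (c : V) → (∀ {x y} → E x y → x ≡ c ⊎ y ≡ c) → ¬ Cycle E
  star-acyclic c hub (_ , [] , _ , () , _)
  star-acyclic c hub (v₀ , r ∷ rest , vₖ , _ , (v₀∉ ∷ r∉ ∷ _) , cons v₀r path , vₖv₀)
    with hub v₀r
  ... | inj₁ v₀≡c with successor rest path
  ...   | w , rw , w∈ with hub rw
  ...     | inj₁ r≡c = ≡-both (All.head v₀∉) v₀≡c r≡c
  ...     | inj₂ w≡c = ≡-both (All.lookup (All.tail v₀∉) w∈) v₀≡c w≡c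
  star-acyclic c hub (v₀ , r ∷ rest , vₖ , _ , (v₀∉ ∷ r∉ ∷ _) , cons v₀r path , vₖv₀)
      | inj₂ r≡c with hub vₖv₀
  ...   | inj₁ vₖ≡c = ≡-both (All.lookup r∉ (∈-++⁺ʳ rest (here refl))) r≡c vₖ≡c
  ...   | inj₂ v₀≡c = ≡-both (All.head v₀∉) v₀≡c r≡c

module _ {V : Set} (G : Graph V) where

  data Spoke (c : V) (P : V → Set) : V → V → Set where
    outward : ∀ {y} → P y → Adj G c y → Spoke c P c y
    inward  : ∀ {x} → P x → Adj G c x → Spoke c P x c

  star : (c : V) (P : V → Set) → P c → (∀ {x} → P x → x ≡ c ⊎ Adj G c x) → Tree G
  star c P Pc spokes = record
    { VZ        = P
    ; EZ        = Spoke c P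
    ; EZ⊆G      = λ { (outward _ a) → a ; (inward _ a) → Adj-sym G a }
    ; EZ-sym    = λ { (outward p a) → inward p a ; (inward p a) → outward p a }
    ; EZ-left   = λ { (outward _ _) → Pc ; (inward p _) → p }
    ; nonempty  = c , Pc
    ; connected = walk
    ; acyclic   = star-acyclic c λ { (outward _ _) → inj₁ refl ; (inward _ _) → inj₂ refl }
    }
    where
    from-centre : ∀ {y} → P y → Walk (Spoke c P) c y
    from-centre Py with spokes Py
    ... | inj₁ refl = here
    ... | inj₂ a    = step (outward Py a) here

    walk : ∀ {x y} → P x → P y → Walk (Spoke c P) x y
    walk Px Py with spokes Px
    ... | inj₁ refl = from-centre Py
    ... | inj₂ a    = step (inward Px a) (from-centre Py)

  star-proper : ∀ {c P} (col : V → Bool) → (∀ {x} → P x → Adj G c x → col c ≢ col x) →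
                ∀ {x y} → Spoke c P x y → col x ≢ col y
  star-proper col leaf (outward p a) = leaf p a
  star-proper col leaf (inward p a)  = λ e → leaf p a (sym e)

record OddModelOver {V : Set} (G : Graph V) (L : Set) : Set₁ where
  field
    Z        : L → Tree G
    disjoint : ∀ {k k'} → k ≢ k' → ∀ {x} → VZ (Z k) x → VZ (Z k') x → ⊥
    c        : V → Bool
    proper   : ∀ k {x y} → EZ (Z k) x y → c x ≢ c y
    touching : ∀ {k k'} → k ≢ k' →
               ∃ λ (xy : V × V) → let (x , y) = xy in
                 Adj G x y × VZ (Z k) x × VZ (Z k') y × c x ≡ c y

  relabel : ∀ {m} → Fin m ↣ L → m ≤oh G
  relabel ι = record
    { Z        = λ k → Z (to k)
    ; disjoint = λ k≢k' → disjoint (λ e → k≢k' (injective e))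
    ; c        = c
    ; proper   = λ k → proper (to k)
    ; touching = λ k≢k' → touching (λ e → k≢k' (injective e))
    }
    where open Injection ι

module K□K (s t : ℕ) where

  Cell : Set
  Cell = Fin (suc s) × Fin (suc t)

  G : Graph Cell
  G = K (suc s) □ K (suc t)

  colour : Cell → Bool
  colour (zero  , _) = false
  colour (suc _ , _) = true

  point : Fin s → Tree G
  point i = star G (suc i , zero) (_≡ (suc i , zero)) refl inj₁

  InColumn : Fin t → Cell → Set
  InColumn j (_ , b) = b ≡ suc j

  column : Fin t → Tree G
  column j = star G (zero , suc j) (InColumn j) refl spokes
    where
    spokes : ∀ {x} → InColumn j x → x ≡ (zero , suc j) ⊎ Adj G (zero , suc j) x
    spokes {zero  , _} refl = inj₁ refl
    spokes {suc _ , _} refl = inj₂ (inj₂ (refl , λ ()))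

  tree : Fin s ⊎ Fin t → Tree G
  tree (inj₁ i) = point i
  tree (inj₂ j) = column j

  disjoint : ∀ {k k'} → k ≢ k' → ∀ {x} → VZ (tree k) x → VZ (tree k') x → ⊥
  disjoint {inj₁ _} {inj₁ _} k≢k' refl refl = k≢k' refl
  disjoint {inj₁ _} {inj₂ _} _    refl ()
  disjoint {inj₂ _} {inj₁ _} _    ()   refl
  disjoint {inj₂ _} {inj₂ _} k≢k' refl refl = k≢k' refl

  proper : ∀ k {x y} → EZ (tree k) x y → colour x ≢ colour y
  proper (inj₁ _) = star-proper G colour λ { refl a → ⊥-elim (irrefl G a) }
  proper (inj₂ _) = star-proper G colour λ
    { {zero  , _} refl a → ⊥-elim (irrefl G a)
    ; {suc _ , _} refl _ → λ ()
    }

  touching : ∀ {k k'} → k ≢ k' →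
             ∃ λ (xy : Cell × Cell) → let (x , y) = xy in
               Adj G x y × VZ (tree k) x × VZ (tree k') y × colour x ≡ colour y
  touching {inj₁ i} {inj₁ i'} k≢k' =
    ((suc i , zero) , (suc i' , zero)) , inj₂ (refl , λ { refl → k≢k' refl }) , refl , refl , refl
  touching {inj₁ i} {inj₂ j'} _ =
    ((suc i , zero) , (suc i , suc j')) , inj₁ (refl , λ ()) , refl , refl , refl
  touching {inj₂ j} {inj₁ i'} _ =
    ((suc i' , suc j) , (suc i' , zero)) , inj₁ (refl , λ ()) , refl , refl , refl
  touching {inj₂ j} {inj₂ j'} k≢k' =
    ((zero , suc j) , (zero , suc j')) , inj₁ (refl , λ { refl → k≢k' refl }) , refl , refl , refl

  model : OddModelOver G (Fin s ⊎ Fin t)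
  model = record
    { Z = tree ; disjoint = disjoint ; c = colour ; proper = proper ; touching = touching }

+≤oh-Ksuc□Ksuc : (s t : ℕ) → (s + t) ≤oh (K (suc s) □ K (suc t))
+≤oh-Ksuc□Ksuc s t = OddModelOver.relabel (K□K.model s t) (↔⇒↣ +↔⊎)

theorem8 : (s t : ℕ) → 2 ≤ s → 2 ≤ t → ((s + t) ∸ 2) ≤oh (K s □ K t)
theorem8 0       _       () _
theorem8 (suc _) 0       _  ()
theorem8 (suc s) (suc t) _  _ =
  subst (_≤oh (K (suc s) □ K (suc t))) (sym (cong (_∸ 1) (+-suc s t))) (+≤oh-Ksuc□Ksuc s t)
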